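{- For every partition $\lambda$, $$p_\lambda=\sum_{\alpha:\ \widetilde\alpha=\lambda}\mathcal p_\alpha ,$$ where the sum is over all compositions $\alpha$ whose underlying partition $\widetilde\alpha$ equals $\lambda$, and $p_\lambda$ is the power sum symmetric function $p_\lambda=\prod_{i=1}^{\ell(\lambda)}\sum_{j\ge1}x_j^{\lambda_i}$ (viewed as a quasisymmetric function).
   Context: Let $\mathbb N=\{1,2,3,\dots\}$. A composition $\alpha=\alpha_1\cdots\alpha_{\ell(\alpha)}$ is a finite sequence of positive integers; its underlying partition $\widetilde\alpha$ is obtained by sorting its parts in weakly decreasing order. A labelling of a finite poset $P$ is an injective map $\gamma$ from $P$ to a chain (totally ordered set); a weight function is a map $w:P\to\mathbb N$. A $(P,\gamma)$-partition is a map $f:P\to\mathbb N$ such that for all $p<q$ in $P$: $f(p)\le f(q)$, and $f(p)=f(q)$ implies $\gamma(p)<\gamma(q)$. Define $K_{(P,\gamma,w)}=\sum_f\prod_{u\in P}x_{f(u)}^{w(u)}$, summed over all $(P,\gamma)$-partitions $f$. For a finite chain $s$ with elements $u_1<\dots<u_\ell$ and weight $w$, let $\alpha(s,w)=(w(u_1),\dots,w(u_\ell))$. Let $\mathbb N_{\mathbb N}=\{a_k: a,k\in\mathbb N\}$ be totally ordered by $a_k<b_l$ iff $a<b$, or $a=b$ and $k<l$, and let $\mathbb N_{\mathbb N}^*$ be the same set with the reverse order. For a composition $\alpha$ with $\widetilde\alpha=n^{r_n}\cdots1^{r_1}$ (i.e. $r_i$ parts equal to $i$), let $P^{\widetilde\alpha}$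 be the poset with no strict relations on the set $\{a_k:1\le a\le n,\ 1\le k\le r_a\}$, with weight $w(a_k)=a$ and labelling $\gamma:P^{\widetilde\alpha}\to\mathbb N_{\mathbb N}^*$ the inclusion. The combinatorial power sum is $\mathcal p_\alpha=\sum_s K_{(s,\gamma,w)}$, summed over all linear extensions $s$ of $P^{\widetilde\alpha}$ (total orders on its underlying set) with $\alpha(s,w)=\alpha$, where $\gamma,w$ are restricted to the chain $s$. -}

module Defs where

open import Data.Bool using (Bool; true; false; if_then_else_; _∧_; _∨_; not)
open import Data.Bool.ListAction using (and)
open import Data.Nat using (ℕ; zero; suc; _+_; _<_; _≤_; _≤ᵇ_; _<ᵇ_; _≡ᵇ_)
import Data.Nat.Properties as ℕP
open import Data.Fin as F using (Fin; toℕ)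
open import Data.Vec as V using (Vec; []; _∷_)
import Data.Vec.Properties as VP
open import Data.List as L using (List; []; _∷_)
import Data.List.Properties as LP
open import Data.Product using (_×_; _,_; proj₁; proj₂)
open import Relation.Nullary.Decidable using (⌊_⌋)
open import Relation.Binary.PropositionalEquality using (_≡_)
open import Data.List.Relation.Unary.All using (All)
open import Data.List.Relation.Unary.Linked using (Linked)

countB : {A : Set} → (A → Bool) → List A → ℕ
countB p []       = 0
countB p (x ∷ xs) = (if p x then 1 else 0) + countB p xs

sumL : List ℕ → ℕ
sumL []       = 0
sumL (x ∷ xs) = x + sumL xs

allVecs : (m L : ℕ) → List (Vec (Fin L) m)
allVecs zero    L = [] ∷ []
allVecs (suc m) L = L.concatMap (λ i → L.map (i ∷_) (allVecs m L)) (L.allFin L)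

allPairs : ∀ {m} → (Fin m → Fin m → Bool) → Bool
allPairs {m} R =
  and (L.map (λ i → and (L.map (λ j → not (toℕ i <ᵇ toℕ j) ∨ R i j)
                                   (L.allFin m)))
               (L.allFin m))

-- We work with finitely many variables x_1 , … , x_L (Fin L, where the
-- index i : Fin L stands for the variable x_{toℕ i + 1}).  A monomial
-- in these variables is its exponent vector e : Vec ℕ L.  A map
-- f : (elements) → Fin L together with weights w contributes the
-- monomial  ∏_u x_{f u}^{w u} , whose exponent vector is expVec L f w.

expVec : ∀ {m} (L : ℕ) → Vec (Fin L) m → Vec ℕ m → Vec ℕ L
expVec L f w =
  V.tabulate (λ i → V.sum (V.zipWith (λ fu wu → if ⌊ fu F.≟ i ⌋ then wu else 0) f w))

_≡ᵛ_ : ∀ {L} → Vec ℕ L → Vec ℕ L → Bool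
e ≡ᵛ e' = ⌊ VP.≡-dec ℕP._≟_ e e' ⌋

-- Power sum symmetric function
--   p_λ = ∏_{i=1}^{ℓ(λ)} Σ_{j ≥ 1} x_j^{λ_i}
-- Expanding the product, the coefficient of the monomial with exponent
-- vector e (in x_1 … x_L, other variables set to 0) is the number of
-- tuples (j_1 , … , j_ℓ) ∈ [L]^ℓ with ∏ x_{j_i}^{λ_i} = x^e.

powerSumCoeff : (la : List ℕ) (L : ℕ) → Vec ℕ L → ℕ
powerSumCoeff la L e =
  countB (λ j → expVec L j (V.fromList la) ≡ᵛ e) (allVecs (L.length la) L)

-- K_{(s,γ,w)} for a finite chain s = u_1 < … < u_m with labelling γ into
-- a chain C (strict order given by a boolean test _<C_) and weight w.
-- A (s,γ)-partition is f : s → ℕ with, for all i < j,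
--   f(u_i) ≤ f(u_j)  and  f(u_i) = f(u_j) ⇒ γ(u_i) < γ(u_j).
-- chainKCoeff gives the coefficient of x^e (variables x_1 … x_L) in
-- K_{(s,γ,w)} = Σ_f ∏_u x_{f u}^{w u}.

isChainPartition : ∀ {C : Set} (_<C_ : C → C → Bool) {m L : ℕ} →
                   Vec C m → Vec (Fin L) m → Bool
isChainPartition _<C_ γ f =
  allPairs (λ i j →
    let fi = toℕ (V.lookup f i) ; fj = toℕ (V.lookup f j) in
    (fi ≤ᵇ fj) ∧ (not (fi ≡ᵇ fj) ∨ (V.lookup γ i <C V.lookup γ j)))

chainKCoeff : ∀ {C : Set} (_<C_ : C → C → Bool) {m : ℕ} →
              (γ : Vec C m) (w : Vec ℕ m) (L : ℕ) → Vec ℕ L → ℕ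
chainKCoeff _<C_ {m} γ w L e =
  countB (λ f → isChainPartition _<C_ γ f ∧ (expVec L f w ≡ᵛ e)) (allVecs m L)

-- The chain ℕ_ℕ = { a_k } (a_k encoded as the pair (a , k)), ordered by
-- a_k < b_l iff a < b, or a = b and k < l; and its reverse ℕ_ℕ^*.

_<NN_ : ℕ × ℕ → ℕ × ℕ → Bool
(a , k) <NN (b , l) = (a <ᵇ b) ∨ ((a ≡ᵇ b) ∧ (k <ᵇ l))

_<NN*_ : ℕ × ℕ → ℕ × ℕ → Bool
x <NN* y = y <NN x

-- all compositions of n (lists of positive integers summing to n),
-- each exactly once: a composition of n+2 arises from one of n+1 by
-- either prepending a part 1 or increasing the first part by 1.
incHead : List ℕ → List ℕ
incHead []       = []
incHead (x ∷ xs) = suc x ∷ xs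

compositions : ℕ → List (List ℕ)
compositions zero          = [] ∷ []
compositions (suc zero)    = (1 ∷ []) ∷ []
compositions (suc (suc n)) =
  L.concatMap (λ c → (1 ∷ c) ∷ incHead c ∷ []) (compositions (suc n))

insertDesc : ℕ → List ℕ → List ℕ
insertDesc x []       = x ∷ []
insertDesc x (y ∷ ys) = if y ≤ᵇ x then x ∷ y ∷ ys else y ∷ insertDesc x ys

sortDesc : List ℕ → List ℕ
sortDesc []       = []
sortDesc (x ∷ xs) = insertDesc x (sortDesc xs)

underlying : List ℕ → List ℕ
underlying = sortDesc

_≡ˡ_ : List ℕ → List ℕ → Bool
xs ≡ˡ ys = ⌊ LP.≡-dec ℕP._≟_ xs ys ⌋

-- The poset P^λ for a partition λ = n^{r_n} ⋯ 1^{r_1}: its underlying set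
-- { a_k : 1 ≤ a ≤ n , 1 ≤ k ≤ r_a }, listed as the vector obtained by
-- reading λ and giving the k-th occurrence of the part a the name a_k.
-- It has no strict relations; weight w(a_k) = a; labelling γ(a_k) = a_k
-- in ℕ_ℕ^*.

countEq : ℕ → List ℕ → ℕ
countEq a = countB (λ b → a ≡ᵇ b)

elemP : (la : List ℕ) → Fin (L.length la) → ℕ × ℕ
elemP la i = let a = L.lookup la i in (a , suc (countEq a (L.take (toℕ i) la)))

-- A linear extension s of P^λ (P^λ has no strict relations, so these are
-- all total orders on its underlying set) is encoded as a duplicate-free
-- listing  ord = (u_1 , … , u_N)  of the N = ℓ(λ) elements, meaning
-- u_1 < u_2 < … < u_N in s.
isTotalOrderListing : ∀ {N} → Vec (Fin N) N → Bool
isTotalOrderListing ord =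
  allPairs (λ i j → not ⌊ V.lookup ord i F.≟ V.lookup ord j ⌋)

chainLabels : (la : List ℕ) → Vec (Fin (L.length la)) (L.length la) →
              Vec (ℕ × ℕ) (L.length la)
chainLabels la ord = V.map (elemP la) ord

chainWeights : (la : List ℕ) → Vec (Fin (L.length la)) (L.length la) →
               Vec ℕ (L.length la)
chainWeights la ord = V.map proj₁ (chainLabels la ord)

-- Combinatorial power sum  𝓅_α = Σ_s K_{(s,γ,w)} , over linear extensions
-- s of P^{α~} with α(s,w) = α.  combPowerSumCoeff α L e is the
-- coefficient of x^e (variables x_1 … x_L) in 𝓅_α.

combPowerSumCoeff : (α : List ℕ) (L : ℕ) → Vec ℕ L → ℕ
combPowerSumCoeff α L e =
  sumL (L.map (λ ord →
          if isTotalOrderListing ord ∧ (V.toList (chainWeights la ord) ≡ˡ α)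
          then chainKCoeff _<NN*_ (chainLabels la ord) (chainWeights la ord) L e
          else 0)
        (allVecs (L.length la) (L.length la)))
  where la = underlying α

sumCombPowerSumCoeff : (la : List ℕ) (L : ℕ) → Vec ℕ L → ℕ
sumCombPowerSumCoeff la L e =
  sumL (L.map (λ α → if underlying α ≡ˡ la then combPowerSumCoeff α L e else 0)
              (compositions (sumL la)))

IsPartition : List ℕ → Set
IsPartition la = All (λ a → 0 < a) la × Linked (λ a b → b ≤ a) la

{-# OPTIONS --safe #-}
module Submission where

-- Expanding the product, p_λ counts the maps j from P^λ to the variables with monomial x^e.
-- For such a j, ordering P^λ by the value of j, with ties broken by the labels in ℕ_ℕ^*, is a
-- strict total order; j read along a linear extension s is an (s,γ)-partition exactly when s
-- lists P^λ increasingly for this order, and exactly one s does. So the pairs of a linear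
-- extension s and an (s,γ)-partition correspond to the maps j. Each s contributes to 𝓅_α for
-- exactly one α, namely α(s,w), a composition of |λ| with underlying partition λ.

open import Defs

open import Data.Bool using (Bool; true; false; if_then_else_; _∧_; _∨_; not; T)
open import Data.Bool.ListAction using (all; and)
open import Data.Bool.Properties using (T-∧; T-∨)
open import Data.Empty using (⊥-elim)
open import Data.Fin as F using (Fin; toℕ)
open import Data.Fin.Permutation using (Permutation′; permutation; _⟨$⟩ʳ_; _⟨$⟩ˡ_; inverseˡ; inverseʳ)
import Data.Fin.Properties as FP
open import Data.List as L using (List; []; _∷_)
open import Data.List.Membership.Propositional using (_∈_)
open import Data.List.Membership.Propositional.Properties using (∈-allFin; ∈-lookup)
import Data.List.Properties as LP
import Data.List.Relation.Unary.All as All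
open import Data.List.Relation.Unary.All.Properties using (all⁺; all⁻)
open import Data.List.Relation.Unary.Any using (here; there)
open import Data.List.Relation.Unary.Linked as Linked using (Linked; []; [-]; _∷_)
open import Data.Nat using (ℕ; zero; suc; _+_; _*_; _<_; _≤_; _≤ᵇ_; _<ᵇ_; _≡ᵇ_; z≤n; s≤s; s<s⁻¹)
open import Data.Nat.Properties
open import Algebra.Properties.CommutativeSemigroup +-commutativeSemigroup
  using () renaming (interchange to +-interchange; x∙yz≈y∙xz to +-exchangeˡ)
open import Data.Product using (_×_; _,_; proj₁; proj₂; ∃)
open import Data.Sum using (_⊎_; inj₁; inj₂)
open import Data.Unit using (tt)
open import Data.Vec as V using (Vec; []; _∷_)
import Data.Vec.Properties as VP
open import Data.Vec.Relation.Unary.All.Properties using (toList⁺; lookup⁻)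
open import Function using (_∘_; id; flip; Equivalence)
open import Function.Definitions using (Injective)
open import Relation.Binary.Definitions using (DecidableEquality; tri<; tri≈; tri>)
open import Relation.Binary.PropositionalEquality
open import Relation.Nullary using (¬_; Dec; yes; no)
open import Relation.Nullary.Decidable using (⌊_⌋; toWitness; fromWitness)

private
  variable
    A B : Set

𝟙 : Bool → ℕ
𝟙 b = if b then 1 else 0

T⇒¬T-not : ∀ {b} → T b → ¬ T (not b)
T⇒¬T-not {true} _ ()

𝟙-cong : ∀ {a b} → (T a → T b) → (T b → T a) → 𝟙 a ≡ 𝟙 b
𝟙-cong {false} {false} _ _ = refl
𝟙-cong {false} {true}  _ f = ⊥-elim (f _)
𝟙-cong {true}  {false} t _ = ⊥-elim (t _)
𝟙-cong {true}  {true}  _ _ = refl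

T⇒𝟙≡1 : ∀ {b} → T b → 𝟙 b ≡ 1
T⇒𝟙≡1 {true} _ = refl

¬T⇒𝟙≡0 : ∀ {b} → ¬ T b → 𝟙 b ≡ 0
¬T⇒𝟙≡0 {false} _ = refl
¬T⇒𝟙≡0 {true}  ¬t = ⊥-elim (¬t tt)

𝟙-< : ∀ {a b} → ¬ T a → T b → 𝟙 a < 𝟙 b
𝟙-< {false} {true} _ _ = s≤s z≤n
𝟙-< {true}         ¬t _ = ⊥-elim (¬t tt)

𝟙-mono : ∀ {a b} → (T a → T b) → 𝟙 a ≤ 𝟙 b
𝟙-mono {false}         _ = z≤n
𝟙-mono {true}  {true}  _ = ≤-refl
𝟙-mono {true}  {false} t = ⊥-elim (t tt)

𝟙≤1 : ∀ b → 𝟙 b ≤ 1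
𝟙≤1 true  = ≤-refl
𝟙≤1 false = z≤n

𝟙-∧ : ∀ a b → 𝟙 (a ∧ b) ≡ 𝟙 a * 𝟙 b
𝟙-∧ true  b = sym (+-identityʳ (𝟙 b))
𝟙-∧ false b = refl

if-then-0≡𝟙* : ∀ b x → (if b then x else 0) ≡ 𝟙 b * x
if-then-0≡𝟙* true  x = sym (+-identityʳ x)
if-then-0≡𝟙* false x = refl

𝟙*-cong : ∀ b {x y} → (T b → x ≡ y) → 𝟙 b * x ≡ 𝟙 b * y
𝟙*-cong true  eq = cong (_+ 0) (eq tt)
𝟙*-cong false eq = refl

𝟙*-absorb : ∀ {u w} x → (T w → T u) → 𝟙 u * (𝟙 w * x) ≡ 𝟙 w * x
𝟙*-absorb {u} {false} x _   = *-zeroʳ (𝟙 u)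
𝟙*-absorb {u} {true}  x w⇒u = trans (cong (_* (1 * x)) (T⇒𝟙≡1 (w⇒u tt))) (*-identityˡ (1 * x))

𝟙⌊⌋-cong : ∀ {P Q : Set} (p : Dec P) (q : Dec Q) → (P → Q) → (Q → P) → 𝟙 ⌊ p ⌋ ≡ 𝟙 ⌊ q ⌋
𝟙⌊⌋-cong p q f g = 𝟙-cong (λ t → fromWitness (f (toWitness t))) (λ t → fromWitness (g (toWitness t)))

𝟙⌊⌋-× : ∀ {P Q R : Set} (r : Dec R) (p : Dec P) (q : Dec Q) →
        (R → P × Q) → (P × Q → R) → 𝟙 ⌊ r ⌋ ≡ 𝟙 ⌊ p ⌋ * 𝟙 ⌊ q ⌋
𝟙⌊⌋-× r (yes a) (yes b) f g = 𝟙⌊⌋-cong r (yes tt) _ (λ _ → g (a , b))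
𝟙⌊⌋-× r (yes a) (no ¬b) f g = 𝟙⌊⌋-cong r (no id) (¬b ∘ proj₂ ∘ f) ⊥-elim
𝟙⌊⌋-× r (no ¬a) q       f g = 𝟙⌊⌋-cong r (no id) (¬a ∘ proj₁ ∘ f) ⊥-elim

∑ : List A → (A → ℕ) → ℕ
∑ []       h = 0
∑ (x ∷ xs) h = h x + ∑ xs h

infix 5 ∑
syntax ∑ xs (λ x → h) = ∑[ x ∈ xs ] h

∑-cong : ∀ (xs : List A) {f g : A → ℕ} → (∀ x → f x ≡ g x) → ∑ xs f ≡ ∑ xs g
∑-cong []       eq = refl
∑-cong (x ∷ xs) eq = cong₂ _+_ (eq x) (∑-cong xs eq)

∑-zero : ∀ (xs : List A) → ∑[ x ∈ xs ] 0 ≡ 0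
∑-zero []       = refl
∑-zero (x ∷ xs) = ∑-zero xs

∑-distrib-+ : ∀ (xs : List A) (f g : A → ℕ) →
              ∑[ x ∈ xs ] (f x + g x) ≡ ∑ xs f + ∑ xs g
∑-distrib-+ []       f g = refl
∑-distrib-+ (x ∷ xs) f g = trans (cong (f x + g x +_) (∑-distrib-+ xs f g))
                                 (+-interchange (f x) (g x) (∑ xs f) (∑ xs g))

∑-*ˡ : ∀ (xs : List A) c (f : A → ℕ) → ∑[ x ∈ xs ] (c * f x) ≡ c * ∑ xs f
∑-*ˡ []       c f = sym (*-zeroʳ c)
∑-*ˡ (x ∷ xs) c f = trans (cong (c * f x +_) (∑-*ˡ xs c f))
                          (sym (*-distribˡ-+ c (f x) (∑ xs f)))

∑-*ʳ : ∀ (xs : List A) c (f : A → ℕ) → ∑[ x ∈ xs ] (f x * c) ≡ ∑ xs f * c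
∑-*ʳ xs c f = begin
  ∑[ x ∈ xs ] (f x * c) ≡⟨ ∑-cong xs (λ x → *-comm (f x) c) ⟩
  ∑[ x ∈ xs ] (c * f x) ≡⟨ ∑-*ˡ xs c f ⟩
  c * ∑ xs f            ≡⟨ *-comm c (∑ xs f) ⟩
  ∑ xs f * c            ∎
  where open ≡-Reasoning

∑-comm : (xs : List A) (ys : List B) (h : A → B → ℕ) →
         ∑[ x ∈ xs ] ∑[ y ∈ ys ] h x y ≡ ∑[ y ∈ ys ] ∑[ x ∈ xs ] h x y
∑-comm []       ys h = sym (∑-zero ys)
∑-comm (x ∷ xs) ys h = trans (cong (∑ ys (h x) +_) (∑-comm xs ys h))
  (sym (∑-distrib-+ ys (h x) (λ y → ∑[ x ∈ xs ] h x y)))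

∑-++ : ∀ (xs ys : List A) (h : A → ℕ) → ∑ (xs L.++ ys) h ≡ ∑ xs h + ∑ ys h
∑-++ []       ys h = refl
∑-++ (x ∷ xs) ys h = trans (cong (h x +_) (∑-++ xs ys h)) (sym (+-assoc (h x) (∑ xs h) (∑ ys h)))

∑-map : (f : B → A) (xs : List B) (h : A → ℕ) → ∑ (L.map f xs) h ≡ ∑ xs (h ∘ f)
∑-map f []       h = refl
∑-map f (x ∷ xs) h = cong (h (f x) +_) (∑-map f xs h)

∑-concatMap : (f : B → List A) (xs : List B) (h : A → ℕ) →
              ∑ (L.concatMap f xs) h ≡ ∑[ x ∈ xs ] ∑ (f x) h
∑-concatMap f []       h = refl
∑-concatMap f (x ∷ xs) h =
  trans (∑-++ (f x) (L.concatMap f xs) h) (cong (∑ (f x) h +_) (∑-concatMap f xs h))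

∑-cong-All : ∀ {P : A → Set} {xs : List A} {f g : A → ℕ} → All.All P xs →
             (∀ x → P x → f x ≡ g x) → ∑ xs f ≡ ∑ xs g
∑-cong-All All.[]         eq = refl
∑-cong-All (px All.∷ pxs) eq = cong₂ _+_ (eq _ px) (∑-cong-All pxs eq)

∑-mono-≤ : ∀ (xs : List A) {f g : A → ℕ} → (∀ x → f x ≤ g x) → ∑ xs f ≤ ∑ xs g
∑-mono-≤ []       le = z≤n
∑-mono-≤ (x ∷ xs) le = +-mono-≤ (le x) (∑-mono-≤ xs le)

∑-mono-< : ∀ {xs : List A} {f g : A → ℕ} {x₀} → (∀ x → f x ≤ g x) →
           x₀ ∈ xs → f x₀ < g x₀ → ∑ xs f < ∑ xs g
∑-mono-< {xs = x ∷ xs} le (here refl)  lt = +-mono-<-≤ lt (∑-mono-≤ xs le)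
∑-mono-< {xs = x ∷ xs} le (there x₀∈) lt = +-mono-≤-< (le x) (∑-mono-< le x₀∈ lt)

∑-const-1 : ∀ (xs : List A) → ∑[ x ∈ xs ] 1 ≡ L.length xs
∑-const-1 []       = refl
∑-const-1 (x ∷ xs) = cong suc (∑-const-1 xs)

countB≡∑𝟙 : ∀ (p : A → Bool) xs → countB p xs ≡ ∑[ x ∈ xs ] 𝟙 (p x)
countB≡∑𝟙 p []       = refl
countB≡∑𝟙 p (x ∷ xs) = cong (𝟙 (p x) +_) (countB≡∑𝟙 p xs)

sumL-map : ∀ (h : A → ℕ) xs → sumL (L.map h xs) ≡ ∑ xs h
sumL-map h []       = refl
sumL-map h (x ∷ xs) = cong (h x +_) (sumL-map h xs)

sumL≡∑ : ∀ xs → sumL xs ≡ ∑ xs id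
sumL≡∑ xs = trans (cong sumL (sym (LP.map-id xs))) (sumL-map id xs)

∑-allFin-suc : ∀ n (h : Fin (suc n) → ℕ) → ∑ (L.allFin (suc n)) h ≡ h F.zero + ∑ (L.allFin n) (h ∘ F.suc)
∑-allFin-suc n h = cong (h F.zero +_) (begin
  ∑ (L.tabulate F.suc) h            ≡⟨ cong (λ xs → ∑ xs h) (sym (LP.map-tabulate id F.suc)) ⟩
  ∑ (L.map F.suc (L.allFin n)) h    ≡⟨ ∑-map F.suc (L.allFin n) h ⟩
  ∑ (L.allFin n) (h ∘ F.suc)        ∎)
  where open ≡-Reasoning

∑-allFin-<ᵇ : ∀ n (k : Fin n) → ∑[ k′ ∈ L.allFin n ] 𝟙 (toℕ k′ <ᵇ toℕ k) ≡ toℕ k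
∑-allFin-<ᵇ (suc n) k = trans (∑-allFin-suc n (λ k′ → 𝟙 (toℕ k′ <ᵇ toℕ k))) (count k)
  where
  count : ∀ k → 𝟙 (0 <ᵇ toℕ k) + (∑[ k′ ∈ L.allFin n ] 𝟙 (suc (toℕ k′) <ᵇ toℕ k)) ≡ toℕ k
  count F.zero    = ∑-zero (L.allFin n)
  count (F.suc k) = cong suc (∑-allFin-<ᵇ n k)

∑-lookup : (xs : List A) (h : A → ℕ) → ∑ xs h ≡ ∑[ i ∈ L.allFin (L.length xs) ] h (L.lookup xs i)
∑-lookup []       h = refl
∑-lookup (x ∷ xs) h = trans (cong (h x +_) (∑-lookup xs h)) (sym (∑-allFin-suc (L.length xs) _))

∑-toList : ∀ {n} (v : Vec A n) (h : A → ℕ) → ∑ (V.toList v) h ≡ ∑[ k ∈ L.allFin n ] h (V.lookup v k)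
∑-toList []            h = refl
∑-toList {n = suc n} (x ∷ v) h = trans (cong (h x +_) (∑-toList v h)) (sym (∑-allFin-suc n _))

sum-zipWith : ∀ {n} (g : A → B → ℕ) (u : Vec A n) (v : Vec B n) →
              V.sum (V.zipWith g u v) ≡ ∑[ k ∈ L.allFin n ] g (V.lookup u k) (V.lookup v k)
sum-zipWith g []      []      = refl
sum-zipWith {n = suc n} g (x ∷ u) (y ∷ v) =
  trans (cong (g x y +_) (sum-zipWith g u v)) (sym (∑-allFin-suc n _))

lookup-fromList : ∀ (xs : List ℕ) i → V.lookup (V.fromList xs) i ≡ L.lookup xs i
lookup-fromList (x ∷ xs) F.zero    = refl
lookup-fromList (x ∷ xs) (F.suc i) = lookup-fromList xs i

module _ {A : Set} (_≟_ : DecidableEquality A) where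

  δ : A → A → ℕ
  δ a b = 𝟙 ⌊ a ≟ b ⌋

  δ-cong : ∀ {a b c d} → (a ≡ b → c ≡ d) → (c ≡ d → a ≡ b) → δ a b ≡ δ c d
  δ-cong {a} {b} {c} {d} = 𝟙⌊⌋-cong (a ≟ b) (c ≟ d)

  δ-refl : ∀ a → δ a a ≡ 1
  δ-refl a = T⇒𝟙≡1 (fromWitness refl)

  δ-≢ : ∀ {a b} → a ≢ b → δ a b ≡ 0
  δ-≢ {a} {b} a≢b = ¬T⇒𝟙≡0 (a≢b ∘ toWitness {a? = a ≟ b})

  δ*-pick : ∀ a x (h : A → ℕ) → δ a x * h x ≡ δ a x * h a
  δ*-pick a x h with a ≟ x
  ... | yes refl = refl
  ... | no  _    = refl

  Enumerates : List A → Set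
  Enumerates xs = ∀ a → ∑[ x ∈ xs ] δ a x ≡ 1

  ∑-δ* : ∀ xs → Enumerates xs → ∀ a (h : A → ℕ) → ∑[ x ∈ xs ] (δ a x * h x) ≡ h a
  ∑-δ* xs enum a h = begin
    ∑[ x ∈ xs ] (δ a x * h x) ≡⟨ ∑-cong xs (λ x → δ*-pick a x h) ⟩
    ∑[ x ∈ xs ] (δ a x * h a) ≡⟨ ∑-*ʳ xs (h a) (δ a) ⟩
    ∑ xs (δ a) * h a          ≡⟨ cong (_* h a) (enum a) ⟩
    1 * h a                   ≡⟨ *-identityˡ (h a) ⟩
    h a                       ∎
    where open ≡-Reasoning

  ∑-bijection : ∀ xs → Enumerates xs → (π π⁻¹ : A → A) →
                (∀ a → π (π⁻¹ a) ≡ a) → (∀ a → π⁻¹ (π a) ≡ a) →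
                ∀ h → ∑[ x ∈ xs ] h (π x) ≡ ∑ xs h
  ∑-bijection xs enum π π⁻¹ ππ⁻¹ π⁻¹π h = begin
    ∑[ x ∈ xs ] h (π x)                           ≡⟨ ∑-cong xs (λ x → sym (∑-δ* xs enum (π x) h)) ⟩
    ∑[ x ∈ xs ] ∑[ y ∈ xs ] (δ (π x) y * h y)     ≡⟨ ∑-comm xs xs _ ⟩
    ∑[ y ∈ xs ] ∑[ x ∈ xs ] (δ (π x) y * h y)     ≡⟨ ∑-cong xs (λ y → ∑-cong xs (λ x →
                                                       cong (_* h y) (δ-transpose x y))) ⟩
    ∑[ y ∈ xs ] ∑[ x ∈ xs ] (δ (π⁻¹ y) x * h y)   ≡⟨ ∑-cong xs (λ y → ∑-*ʳ xs (h y) (δ (π⁻¹ y))) ⟩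
    ∑[ y ∈ xs ] (∑ xs (δ (π⁻¹ y)) * h y)          ≡⟨ ∑-cong xs (λ y → trans (cong (_* h y) (enum (π⁻¹ y)))
                                                                          (*-identityˡ (h y))) ⟩
    ∑ xs h                                        ∎
    where
    open ≡-Reasoning
    δ-transpose : ∀ x y → δ (π x) y ≡ δ (π⁻¹ y) x
    δ-transpose x y = δ-cong (λ eq → trans (cong π⁻¹ (sym eq)) (π⁻¹π x))
                             (λ eq → trans (cong π (sym eq)) (ππ⁻¹ y))

allFin-enumerates : ∀ n → Enumerates F._≟_ (L.allFin n)
allFin-enumerates (suc n) a = trans (∑-allFin-suc n (δ F._≟_ a)) (count a)
  where
  count : ∀ a → δ F._≟_ a F.zero + (∑[ i ∈ L.allFin n ] δ F._≟_ a (F.suc i)) ≡ 1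
  count F.zero     = cong suc (∑-zero (L.allFin n))
  count (F.suc a) = trans (∑-cong (L.allFin n) (λ i → 𝟙⌊⌋-cong (F.suc a F.≟ F.suc i) (a F.≟ i)
                                                          FP.suc-injective (cong F.suc)))
                          (allFin-enumerates n a)

δ-∷ : ∀ {m L} (i k : Fin L) (u v : Vec (Fin L) m) →
      δ (VP.≡-dec F._≟_) (i ∷ u) (k ∷ v) ≡ δ F._≟_ i k * δ (VP.≡-dec F._≟_) u v
δ-∷ i k u v = 𝟙⌊⌋-× (VP.≡-dec F._≟_ (i ∷ u) (k ∷ v)) (i F.≟ k) (VP.≡-dec F._≟_ u v)
  VP.∷-injective (λ { (refl , refl) → refl })

allVecs-enumerates : ∀ m L → Enumerates (VP.≡-dec F._≟_) (allVecs m L)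
allVecs-enumerates zero    L []      = refl
allVecs-enumerates (suc m) L (i ∷ u) = begin
  ∑ (allVecs (suc m) L) (δ _≟ᵛ_ (i ∷ u))
    ≡⟨ ∑-concatMap (λ k → L.map (k ∷_) (allVecs m L)) (L.allFin L) _ ⟩
  ∑[ k ∈ L.allFin L ] ∑ (L.map (k ∷_) (allVecs m L)) (δ _≟ᵛ_ (i ∷ u))
    ≡⟨ ∑-cong (L.allFin L) (λ k → ∑-map (k ∷_) (allVecs m L) _) ⟩
  ∑[ k ∈ L.allFin L ] ∑[ v ∈ allVecs m L ] δ _≟ᵛ_ (i ∷ u) (k ∷ v)
    ≡⟨ ∑-cong (L.allFin L) (λ k → trans (∑-cong (allVecs m L) (δ-∷ i k u))
                                        (∑-*ˡ (allVecs m L) (δ F._≟_ i k) _)) ⟩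
  ∑[ k ∈ L.allFin L ] (δ F._≟_ i k * ∑ (allVecs m L) (δ _≟ᵛ_ u))
    ≡⟨ ∑-cong (L.allFin L) (λ k → trans (cong (δ F._≟_ i k *_) (allVecs-enumerates m L u))
                                        (*-identityʳ _)) ⟩
  ∑ (L.allFin L) (δ F._≟_ i)
    ≡⟨ allFin-enumerates L i ⟩
  1 ∎
  where
  open ≡-Reasoning
  _≟ᵛ_ : ∀ {m} → DecidableEquality (Vec (Fin L) m)
  _≟ᵛ_ = VP.≡-dec F._≟_

-- If i had no preimage, punching it out would inject Fin (suc m) into Fin m.
injective⇒preimage : ∀ {n} {σ : Fin n → Fin n} → Injective _≡_ _≡_ σ → ∀ i → ∃ λ k → σ k ≡ i
injective⇒preimage {suc m} {σ} σ-inj i with FP.any? (λ k → σ k F.≟ i)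
... | yes hit = hit
... | no  ∄k  = ⊥-elim (1+n≰n (FP.injective⇒≤ σ′-inj))
  where
  σ≢i : ∀ k → i ≢ σ k
  σ≢i k eq = ∄k (k , sym eq)
  σ′ : Fin (suc m) → Fin m
  σ′ k = F.punchOut (σ≢i k)
  σ′-inj : Injective _≡_ _≡_ σ′
  σ′-inj {k} {k′} eq = σ-inj (FP.punchOut-injective (σ≢i k) (σ≢i k′) eq)

injective⇒permutation : ∀ {n} (σ : Fin n → Fin n) → Injective _≡_ _≡_ σ → Permutation′ n
injective⇒permutation σ σ-inj = permutation σ (proj₁ ∘ preimage) (proj₂ ∘ preimage)
                                            (λ k → σ-inj (proj₂ (preimage (σ k))))
  where
  preimage : ∀ i → ∃ λ k → σ k ≡ i
  preimage = injective⇒preimage σ-inj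

∑-permute : ∀ {n} (π : Permutation′ n) (h : Fin n → ℕ) →
            ∑[ k ∈ L.allFin n ] h (π ⟨$⟩ʳ k) ≡ ∑ (L.allFin n) h
∑-permute {n} π = ∑-bijection F._≟_ (L.allFin n) (allFin-enumerates n)
                              (π ⟨$⟩ʳ_) (π ⟨$⟩ˡ_) (λ _ → inverseʳ π) (λ _ → inverseˡ π)

reorder : ∀ {n} → (Fin n → Fin n) → Vec A n → Vec A n
reorder σ v = V.tabulate (V.lookup v ∘ σ)

lookup-reorder : ∀ {n} (σ : Fin n → Fin n) (v : Vec A n) k → V.lookup (reorder σ v) k ≡ V.lookup v (σ k)
lookup-reorder σ v = VP.lookup∘tabulate (V.lookup v ∘ σ)

reorder-inverse : ∀ {n} {σ τ : Fin n → Fin n} → (∀ k → τ (σ k) ≡ k) →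
                  ∀ (v : Vec A n) → reorder σ (reorder τ v) ≡ v
reorder-inverse {σ = σ} {τ} τσ v = trans
  (VP.tabulate-cong (λ k → trans (lookup-reorder τ v (σ k)) (cong (V.lookup v) (τσ k))))
  (VP.tabulate∘lookup v)

∑-allVecs-reorder : ∀ {N L} (π : Permutation′ N) (G : Vec (Fin L) N → ℕ) →
                    ∑[ j ∈ allVecs N L ] G (reorder (π ⟨$⟩ʳ_) j) ≡ ∑ (allVecs N L) G
∑-allVecs-reorder {N} {L} π = ∑-bijection (VP.≡-dec F._≟_) (allVecs N L) (allVecs-enumerates N L)
  (reorder (π ⟨$⟩ʳ_)) (reorder (π ⟨$⟩ˡ_))
  (reorder-inverse (λ _ → inverseˡ π)) (reorder-inverse (λ _ → inverseʳ π))

T-all-allFin : ∀ {n} (p : Fin n → Bool) → T (all p (L.allFin n)) → ∀ i → T (p i)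
T-all-allFin p t i = All.lookup (all⁺ p (L.allFin _) t) (∈-allFin i)

all-allFin-T : ∀ {n} (p : Fin n → Bool) → (∀ i → T (p i)) → T (all p (L.allFin n))
all-allFin-T p h = all⁻ p {xs = L.allFin _} (All.tabulate (λ {i} _ → h i))

T-allPairs : ∀ {m} (R : Fin m → Fin m → Bool) → T (allPairs R) →
             ∀ {i j} → toℕ i < toℕ j → T (R i j)
T-allPairs R t {i} {j} i<j with Equivalence.to T-∨ (T-all-allFin _ (T-all-allFin _ t i) j)
... | inj₁ i≮j = ⊥-elim (T⇒¬T-not (<⇒<ᵇ i<j) i≮j)
... | inj₂ r = r

allPairs-T : ∀ {m} (R : Fin m → Fin m → Bool) →
             (∀ {i j} → toℕ i < toℕ j → T (R i j)) → T (allPairs R)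
allPairs-T R h = all-allFin-T _ (λ i → all-allFin-T _ (λ j → pair i j))
  where
  pair : ∀ i j → T (not (toℕ i <ᵇ toℕ j) ∨ R i j)
  pair i j with toℕ i <ᵇ toℕ j in eq
  ... | false = tt
  ... | true  = h (<ᵇ⇒< (toℕ i) (toℕ j) (subst T (sym eq) tt))

allPairs-cong : ∀ {m} {R R′ : Fin m → Fin m → Bool} → (∀ i j → R i j ≡ R′ i j) → allPairs R ≡ allPairs R′
allPairs-cong {m} eq = cong and (LP.map-cong (λ i → cong and
  (LP.map-cong (λ j → cong (not (toℕ i <ᵇ toℕ j) ∨_) (eq i j)) (L.allFin m))) (L.allFin m))

separated⇒injective : ∀ {n} (f : Fin n → A) →
                      (∀ {a b} → toℕ a < toℕ b → f a ≢ f b) → Injective _≡_ _≡_ f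
separated⇒injective f sep {a} {b} eq with <-cmp (toℕ a) (toℕ b)
... | tri< a<b _ _ = ⊥-elim (sep a<b eq)
... | tri≈ _ a≡b _ = FP.toℕ-injective a≡b
... | tri> _ _ b<a = ⊥-elim (sep b<a (sym eq))

T-isTotalOrderListing⇒injective : ∀ {N} (ord : Vec (Fin N) N) → T (isTotalOrderListing ord) →
                                  Injective _≡_ _≡_ (V.lookup ord)
T-isTotalOrderListing⇒injective ord t = separated⇒injective (V.lookup ord)
  (λ a<b eq → T⇒¬T-not (fromWitness eq) (T-allPairs _ t a<b))

injective⇒T-isTotalOrderListing : ∀ {N} (ord : Vec (Fin N) N) → Injective _≡_ _≡_ (V.lookup ord) →
                                  T (isTotalOrderListing ord)
injective⇒T-isTotalOrderListing ord inj = allPairs-T _ distinct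
  where
  distinct : ∀ {a b} → toℕ a < toℕ b → T (not ⌊ V.lookup ord a F.≟ V.lookup ord b ⌋)
  distinct {a} {b} a<b with V.lookup ord a F.≟ V.lookup ord b
  ... | yes eq = <-irrefl (cong toℕ (inj eq)) a<b
  ... | no  _  = tt

record IsStrictTotalᵇ {A : Set} (_≺_ : A → A → Bool) : Set where
  field
    irreflexive : ∀ x → ¬ T (x ≺ x)
    transitive  : ∀ {x y z} → T (x ≺ y) → T (y ≺ z) → T (x ≺ z)
    connected   : ∀ {x y} → x ≢ y → T (x ≺ y) ⊎ T (y ≺ x)

  asymmetric : ∀ {x y} → T (x ≺ y) → ¬ T (y ≺ x)
  asymmetric {x} x≺y y≺x = irreflexive x (transitive x≺y y≺x)

<ᵇ-isStrictTotal : IsStrictTotalᵇ _<ᵇ_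
<ᵇ-isStrictTotal = record
  { irreflexive = λ x t → <-irrefl refl (<ᵇ⇒< x x t)
  ; transitive  = λ {x} {y} {z} p q → <⇒<ᵇ (<-trans (<ᵇ⇒< x y p) (<ᵇ⇒< y z q))
  ; connected   = λ {x} {y} x≢y → compare x y x≢y
  }
  where
  compare : ∀ x y → x ≢ y → T (x <ᵇ y) ⊎ T (y <ᵇ x)
  compare x y x≢y with <-cmp x y
  ... | tri< x<y _ _ = inj₁ (<⇒<ᵇ x<y)
  ... | tri≈ _ x≡y _ = ⊥-elim (x≢y x≡y)
  ... | tri> _ _ y<x = inj₂ (<⇒<ᵇ y<x)

flip-isStrictTotal : ∀ {_≺_ : A → A → Bool} → IsStrictTotalᵇ _≺_ → IsStrictTotalᵇ (flip _≺_)
flip-isStrictTotal sto = record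
  { irreflexive = irreflexive
  ; transitive  = λ p q → transitive q p
  ; connected   = λ x≢y → connected (x≢y ∘ sym)
  }
  where open IsStrictTotalᵇ sto

on-isStrictTotal : ∀ {_≺_ : A → A → Bool} (k : B → A) → Injective _≡_ _≡_ k →
                   IsStrictTotalᵇ _≺_ → IsStrictTotalᵇ (λ x y → k x ≺ k y)
on-isStrictTotal k k-inj sto = record
  { irreflexive = irreflexive ∘ k
  ; transitive  = transitive
  ; connected   = λ x≢y → connected (x≢y ∘ k-inj)
  }
  where open IsStrictTotalᵇ sto

module _ {A : Set} (_≺_ : A → A → Bool) where

  lexᵇ : ℕ × A → ℕ × A → Bool
  lexᵇ (a , x) (b , y) = (a <ᵇ b) ∨ ((a ≡ᵇ b) ∧ (x ≺ y))

  T-lexᵇ : ∀ {a b x y} → T (lexᵇ (a , x) (b , y)) → a < b ⊎ (a ≡ b × T (x ≺ y))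
  T-lexᵇ {a} {b} t with Equivalence.to T-∨ t
  ... | inj₁ a<b = inj₁ (<ᵇ⇒< a b a<b)
  ... | inj₂ a≡b∧x≺y = let (a≡b , x≺y) = Equivalence.to T-∧ a≡b∧x≺y in inj₂ (≡ᵇ⇒≡ a b a≡b , x≺y)

  lexᵇ-< : ∀ {a b} x y → a < b → T (lexᵇ (a , x) (b , y))
  lexᵇ-< _ _ a<b = Equivalence.from T-∨ (inj₁ (<⇒<ᵇ a<b))

  lexᵇ-≡ : ∀ a {x y} → T (x ≺ y) → T (lexᵇ (a , x) (a , y))
  lexᵇ-≡ a x≺y = Equivalence.from T-∨ (inj₂ (Equivalence.from T-∧ (≡⇒≡ᵇ a a refl , x≺y)))

lex-isStrictTotal : ∀ {_≺_ : A → A → Bool} → IsStrictTotalᵇ _≺_ → IsStrictTotalᵇ (lexᵇ _≺_)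
lex-isStrictTotal {_≺_ = _≺_} sto = record
  { irreflexive = irreflexive′
  ; transitive  = λ {p} {q} {r} → transitive′ {p} {q} {r}
  ; connected   = λ {p} {q} → connected′ {p} {q}
  }
  where
  open IsStrictTotalᵇ sto
  irreflexive′ : ∀ p → ¬ T (lexᵇ _≺_ p p)
  irreflexive′ (a , x) t with T-lexᵇ _≺_ {a} {a} {x} {x} t
  ... | inj₁ a<a       = <-irrefl refl a<a
  ... | inj₂ (_ , x≺x) = irreflexive x x≺x
  transitive′ : ∀ {p q r} → T (lexᵇ _≺_ p q) → T (lexᵇ _≺_ q r) → T (lexᵇ _≺_ p r)
  transitive′ {a , x} {b , y} {c , z} s t with T-lexᵇ _≺_ {a} {b} {x} {y} s | T-lexᵇ _≺_ {b} {c} {y} {z} t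
  ... | inj₁ a<b          | inj₁ b<c          = lexᵇ-< _≺_ x z (<-trans a<b b<c)
  ... | inj₁ a<b          | inj₂ (refl , _)   = lexᵇ-< _≺_ x z a<b
  ... | inj₂ (refl , _)   | inj₁ b<c          = lexᵇ-< _≺_ x z b<c
  ... | inj₂ (refl , x≺y) | inj₂ (refl , y≺z) = lexᵇ-≡ _≺_ a (transitive x≺y y≺z)
  connected′ : ∀ {p q} → p ≢ q → T (lexᵇ _≺_ p q) ⊎ T (lexᵇ _≺_ q p)
  connected′ {a , x} {b , y} p≢q with <-cmp a b
  ... | tri< a<b _ _    = inj₁ (lexᵇ-< _≺_ x y a<b)
  ... | tri> _ _ b<a    = inj₂ (lexᵇ-< _≺_ y x b<a)
  ... | tri≈ _ refl _ with connected (λ x≡y → p≢q (cong (a ,_) x≡y))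
  ...   | inj₁ x≺y = inj₁ (lexᵇ-≡ _≺_ a x≺y)
  ...   | inj₂ y≺x = inj₂ (lexᵇ-≡ _≺_ a y≺x)

<NN-isStrictTotal : IsStrictTotalᵇ _<NN_
<NN-isStrictTotal = lex-isStrictTotal <ᵇ-isStrictTotal

-- The increasing listing is the inverse of the rank i ↦ #{x | x ≺ i}.
module IncreasingListings {N : ℕ} {_≺_ : Fin N → Fin N → Bool} (sto : IsStrictTotalᵇ _≺_) where
  open IsStrictTotalᵇ sto

  Increasing : (Fin N → Fin N) → Set
  Increasing σ = ∀ {a b} → toℕ a < toℕ b → T (σ a ≺ σ b)

  rank : Fin N → ℕ
  rank i = ∑[ x ∈ L.allFin N ] 𝟙 (x ≺ i)

  rank<N : ∀ i → rank i < N
  rank<N i = begin-strict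
    rank i                    <⟨ ∑-mono-< (λ x → 𝟙≤1 (x ≺ i)) (∈-allFin i) (𝟙-< (irreflexive i) tt) ⟩
    ∑[ x ∈ L.allFin N ] 1     ≡⟨ ∑-const-1 (L.allFin N) ⟩
    L.length (L.allFin N)     ≡⟨ LP.length-tabulate id ⟩
    N                         ∎
    where open ≤-Reasoning

  rank-mono : ∀ {i j} → T (i ≺ j) → rank i < rank j
  rank-mono {i} i≺j = ∑-mono-< (λ x → 𝟙-mono (λ x≺i → transitive x≺i i≺j)) (∈-allFin i)
                                (𝟙-< (irreflexive i) i≺j)

  rank-injective : ∀ {i j} → rank i ≡ rank j → i ≡ j
  rank-injective {i} {j} eq with i F.≟ j
  ... | yes i≡j = i≡j
  ... | no  i≢j with connected i≢j
  ...   | inj₁ i≺j = ⊥-elim (<-irrefl eq (rank-mono i≺j))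
  ...   | inj₂ j≺i = ⊥-elim (<-irrefl (sym eq) (rank-mono j≺i))

  rank-increasing : ∀ (π : Permutation′ N) → Increasing (π ⟨$⟩ʳ_) → ∀ k → rank (π ⟨$⟩ʳ k) ≡ toℕ k
  rank-increasing π increasing k = begin
    ∑[ x ∈ L.allFin N ] 𝟙 (x ≺ σ k)            ≡⟨ ∑-permute π (λ x → 𝟙 (x ≺ σ k)) ⟨
    ∑[ k′ ∈ L.allFin N ] 𝟙 (σ k′ ≺ σ k)        ≡⟨ ∑-cong (L.allFin N) (λ k′ → 𝟙-cong (below k′)
                                                      (increasing ∘ <ᵇ⇒< (toℕ k′) (toℕ k))) ⟩
    ∑[ k′ ∈ L.allFin N ] 𝟙 (toℕ k′ <ᵇ toℕ k)   ≡⟨ ∑-allFin-<ᵇ N k ⟩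
    toℕ k                                      ∎
    where
    open ≡-Reasoning
    σ : Fin N → Fin N
    σ = π ⟨$⟩ʳ_
    below : ∀ k′ → T (σ k′ ≺ σ k) → T (toℕ k′ <ᵇ toℕ k)
    below k′ σk′≺σk with <-cmp (toℕ k′) (toℕ k)
    ... | tri< k′<k _ _ = <⇒<ᵇ k′<k
    ... | tri≈ _ k′≡k _ = ⊥-elim (irreflexive (σ k) (subst (λ x → T (σ x ≺ σ k)) (FP.toℕ-injective k′≡k) σk′≺σk))
    ... | tri> _ _ k<k′ = ⊥-elim (asymmetric σk′≺σk (increasing k<k′))

  rankᶠ : Fin N → Fin N
  rankᶠ i = F.fromℕ< (rank<N i)

  rankᶠ-injective : Injective _≡_ _≡_ rankᶠ
  rankᶠ-injective {i} {j} eq = rank-injective (begin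
    rank i          ≡⟨ FP.toℕ-fromℕ< (rank<N i) ⟨
    toℕ (rankᶠ i)   ≡⟨ cong toℕ eq ⟩
    toℕ (rankᶠ j)   ≡⟨ FP.toℕ-fromℕ< (rank<N j) ⟩
    rank j          ∎)
    where open ≡-Reasoning

  rank-permutation : Permutation′ N
  rank-permutation = injective⇒permutation rankᶠ rankᶠ-injective

  sorted : Fin N → Fin N
  sorted = rank-permutation ⟨$⟩ˡ_

  sorted-injective : Injective _≡_ _≡_ sorted
  sorted-injective {a} {b} eq = begin
    a                               ≡⟨ inverseʳ rank-permutation ⟨
    rank-permutation ⟨$⟩ʳ sorted a  ≡⟨ cong (rank-permutation ⟨$⟩ʳ_) eq ⟩
    rank-permutation ⟨$⟩ʳ sorted b  ≡⟨ inverseʳ rank-permutation ⟩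
    b                               ∎
    where open ≡-Reasoning

  rank-sorted : ∀ k → rank (sorted k) ≡ toℕ k
  rank-sorted k = trans (sym (FP.toℕ-fromℕ< (rank<N (sorted k)))) (cong toℕ (inverseʳ rank-permutation))

  sorted-increasing : Increasing sorted
  sorted-increasing {a} {b} a<b with connected (λ eq → <-irrefl (cong toℕ (sorted-injective eq)) a<b)
  ... | inj₁ a≺b = a≺b
  ... | inj₂ b≺a = ⊥-elim (<-asym a<b (subst₂ _<_ (rank-sorted b) (rank-sorted a) (rank-mono b≺a)))

  increasing-unique : ∀ (π : Permutation′ N) → Increasing (π ⟨$⟩ʳ_) → ∀ k → π ⟨$⟩ʳ k ≡ sorted k
  increasing-unique π increasing k =
    rank-injective (trans (rank-increasing π increasing k) (sym (rank-sorted k)))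

  increasingᵇ : Vec (Fin N) N → Bool
  increasingᵇ ord = allPairs (λ a b → V.lookup ord a ≺ V.lookup ord b)

  sorted-listing : Vec (Fin N) N
  sorted-listing = V.tabulate sorted

  lookup-sorted-listing : ∀ k → V.lookup sorted-listing k ≡ sorted k
  lookup-sorted-listing = VP.lookup∘tabulate sorted

  sorted-listing-increasing : T (isTotalOrderListing sorted-listing ∧ increasingᵇ sorted-listing)
  sorted-listing-increasing = Equivalence.from T-∧
    ( injective⇒T-isTotalOrderListing sorted-listing (λ {a} {b} eq → sorted-injective (begin
        sorted a                     ≡⟨ lookup-sorted-listing a ⟨
        V.lookup sorted-listing a    ≡⟨ eq ⟩
        V.lookup sorted-listing b    ≡⟨ lookup-sorted-listing b ⟩
        sorted b                     ∎))
    , allPairs-T _ (λ {a} {b} a<b → subst₂ (λ x y → T (x ≺ y))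
                     (sym (lookup-sorted-listing a)) (sym (lookup-sorted-listing b)) (sorted-increasing a<b)) )
    where open ≡-Reasoning

  increasing-listing-unique : ∀ ord → T (isTotalOrderListing ord ∧ increasingᵇ ord) → sorted-listing ≡ ord
  increasing-listing-unique ord t with (listing , increasing) ← Equivalence.to T-∧ t = sym (begin
    ord                        ≡⟨ VP.tabulate∘lookup ord ⟨
    V.tabulate (V.lookup ord)  ≡⟨ VP.tabulate-cong (increasing-unique π (T-allPairs _ increasing)) ⟩
    sorted-listing             ∎)
    where
    open ≡-Reasoning
    π : Permutation′ N
    π = injective⇒permutation (V.lookup ord) (T-isTotalOrderListing⇒injective ord listing)

  ∑-increasing-listings : ∑[ ord ∈ allVecs N N ] 𝟙 (isTotalOrderListing ord ∧ increasingᵇ ord) ≡ 1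
  ∑-increasing-listings = trans
    (∑-cong (allVecs N N) (λ ord → 𝟙-cong (fromWitness ∘ increasing-listing-unique ord)
                                          (λ t → subst (λ o → T (isTotalOrderListing o ∧ increasingᵇ o))
                                                       (toWitness t) sorted-listing-increasing)))
    (allVecs-enumerates N N sorted-listing)

≡ˡ⇒≡ : ∀ {xs ys} → T (xs ≡ˡ ys) → xs ≡ ys
≡ˡ⇒≡ {xs} {ys} = toWitness {a? = LP.≡-dec _≟_ xs ys}

≡⇒≡ˡ : ∀ {xs ys} → xs ≡ ys → T (xs ≡ˡ ys)
≡⇒≡ˡ {xs} {ys} = fromWitness {a? = LP.≡-dec _≟_ xs ys}

Positive : List ℕ → Set
Positive = All.All (0 <_)

compositions-positive : ∀ n → All.All Positive (compositions n)
compositions-positive zero          = All.[] All.∷ All.[]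
compositions-positive (suc zero)    = (s≤s z≤n All.∷ All.[]) All.∷ All.[]
compositions-positive (suc (suc n)) = extend (compositions-positive (suc n))
  where
  incHead-positive : ∀ {d} → Positive d → Positive (incHead d)
  incHead-positive All.[]        = All.[]
  incHead-positive (_ All.∷ d⁺)  = s≤s z≤n All.∷ d⁺
  extend : ∀ {ds} → All.All Positive ds → All.All Positive (L.concatMap (λ d → (1 ∷ d) ∷ incHead d ∷ []) ds)
  extend All.[]          = All.[]
  extend (d⁺ All.∷ ds⁺) = (s≤s z≤n All.∷ d⁺) All.∷ incHead-positive d⁺ All.∷ extend ds⁺

∑-compositions-2+ : ∀ m (h : List ℕ → ℕ) →
  ∑ (compositions (suc (suc m))) h ≡ ∑[ d ∈ compositions (suc m) ] (h (1 ∷ d) + h (incHead d))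
∑-compositions-2+ m h = trans (∑-concatMap _ (compositions (suc m)) h)
  (∑-cong (compositions (suc m)) (λ d → cong (h (1 ∷ d) +_) (+-identityʳ (h (incHead d)))))

≡-incHead : ∀ {x c d} → suc x ∷ c ≡ incHead d → x ∷ c ≡ d
≡-incHead {d = y ∷ d} eq = cong₂ _∷_ (suc-injective (LP.∷-injectiveˡ eq)) (LP.∷-injectiveʳ eq)

1∷-≢-incHead : ∀ {c d} → Positive d → 1 ∷ c ≢ incHead d
1∷-≢-incHead {d = y ∷ d} (0<y All.∷ _) eq = <-irrefl (suc-injective (LP.∷-injectiveˡ eq)) 0<y

compositions-enumerate : ∀ n c → Positive c → sumL c ≡ n → ∑[ α ∈ compositions n ] 𝟙 (c ≡ˡ α) ≡ 1
compositions-enumerate zero    []                _                  _  = δ-refl (LP.≡-dec _≟_) []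
compositions-enumerate (suc _) []                _                  ()
compositions-enumerate _       (zero ∷ _)        (() All.∷ _)       _
compositions-enumerate zero    (suc _ ∷ _)       _                  ()
compositions-enumerate (suc zero) (suc zero ∷ []) _                 _  = δ-refl (LP.≡-dec _≟_) (1 ∷ [])
compositions-enumerate (suc zero) (suc zero ∷ zero ∷ _) (_ All.∷ () All.∷ _) _
compositions-enumerate (suc zero) (suc zero ∷ suc _ ∷ _) _           ()
compositions-enumerate (suc zero) (suc (suc _) ∷ _)      _           ()
compositions-enumerate (suc (suc m)) (suc zero ∷ c) (_ All.∷ c⁺) eq = begin
  ∑[ α ∈ compositions (2 + m) ] 𝟙 ((1 ∷ c) ≡ˡ α)
    ≡⟨ ∑-compositions-2+ m _ ⟩
  ∑[ d ∈ compositions (suc m) ] (𝟙 ((1 ∷ c) ≡ˡ (1 ∷ d)) + 𝟙 ((1 ∷ c) ≡ˡ incHead d))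
    ≡⟨ ∑-cong-All (compositions-positive (suc m)) (λ d d⁺ →
         cong₂ _+_ (δ-cong (LP.≡-dec _≟_) LP.∷-injectiveʳ (cong (1 ∷_)))
                   (δ-≢ (LP.≡-dec _≟_) (1∷-≢-incHead d⁺))) ⟩
  ∑[ d ∈ compositions (suc m) ] (𝟙 (c ≡ˡ d) + 0)
    ≡⟨ ∑-cong (compositions (suc m)) (λ d → +-identityʳ _) ⟩
  ∑[ d ∈ compositions (suc m) ] 𝟙 (c ≡ˡ d)
    ≡⟨ compositions-enumerate (suc m) c c⁺ (suc-injective eq) ⟩
  1 ∎
  where open ≡-Reasoning
compositions-enumerate (suc (suc m)) (suc (suc x) ∷ c) (_ All.∷ c⁺) eq = begin
  ∑[ α ∈ compositions (2 + m) ] 𝟙 ((2 + x ∷ c) ≡ˡ α)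
    ≡⟨ ∑-compositions-2+ m _ ⟩
  ∑[ d ∈ compositions (suc m) ] (𝟙 ((2 + x ∷ c) ≡ˡ (1 ∷ d)) + 𝟙 ((2 + x ∷ c) ≡ˡ incHead d))
    ≡⟨ ∑-cong (compositions (suc m)) (λ d →
         cong₂ _+_ (δ-≢ (LP.≡-dec _≟_) {2 + x ∷ c} {1 ∷ d} (1+n≢0 ∘ suc-injective ∘ LP.∷-injectiveˡ))
                   (δ-cong (LP.≡-dec _≟_) ≡-incHead (cong incHead))) ⟩
  ∑[ d ∈ compositions (suc m) ] 𝟙 ((suc x ∷ c) ≡ˡ d)
    ≡⟨ compositions-enumerate (suc m) (suc x ∷ c) (s≤s z≤n All.∷ c⁺) (suc-injective eq) ⟩
  1 ∎
  where open ≡-Reasoning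

Sorted : List ℕ → Set
Sorted = Linked (λ a b → b ≤ a)

countEq-insertDesc : ∀ a x ys → countEq a (insertDesc x ys) ≡ countEq a (x ∷ ys)
countEq-insertDesc a x []       = refl
countEq-insertDesc a x (y ∷ ys) with y ≤ᵇ x
... | true  = refl
... | false = trans (cong (𝟙 (a ≡ᵇ y) +_) (countEq-insertDesc a x ys))
                    (+-exchangeˡ (𝟙 (a ≡ᵇ y)) (𝟙 (a ≡ᵇ x)) (countEq a ys))

countEq-sortDesc : ∀ a xs → countEq a (sortDesc xs) ≡ countEq a xs
countEq-sortDesc a []       = refl
countEq-sortDesc a (x ∷ xs) = trans (countEq-insertDesc a x (sortDesc xs))
                                    (cong (𝟙 (a ≡ᵇ x) +_) (countEq-sortDesc a xs))

≤ᵇ≡true⇒≤ : ∀ {m n} → (m ≤ᵇ n) ≡ true → m ≤ n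
≤ᵇ≡true⇒≤ {m} {n} eq = ≤ᵇ⇒≤ m n (subst T (sym eq) tt)

≤ᵇ≡false⇒> : ∀ {m n} → (m ≤ᵇ n) ≡ false → n < m
≤ᵇ≡false⇒> eq = ≰⇒> (λ m≤n → subst T eq (≤⇒≤ᵇ m≤n))

insertDesc-below : ∀ {z} x ys → x ≤ z → Sorted (z ∷ ys) → Sorted (z ∷ insertDesc x ys)
insertDesc-below x []       x≤z _                 = x≤z ∷ [-]
insertDesc-below x (y ∷ ys) x≤z (y≤z ∷ y∷ys↘) with y ≤ᵇ x in eq
... | true  = x≤z ∷ ≤ᵇ≡true⇒≤ eq ∷ y∷ys↘
... | false = y≤z ∷ insertDesc-below x ys (<⇒≤ (≤ᵇ≡false⇒> eq)) y∷ys↘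

insertDesc-sorted : ∀ x ys → Sorted ys → Sorted (insertDesc x ys)
insertDesc-sorted x []       _     = [-]
insertDesc-sorted x (y ∷ ys) y∷ys↘ with y ≤ᵇ x in eq
... | true  = ≤ᵇ≡true⇒≤ eq ∷ y∷ys↘
... | false = insertDesc-below x ys (<⇒≤ (≤ᵇ≡false⇒> eq)) y∷ys↘

sortDesc-sorted : ∀ xs → Sorted (sortDesc xs)
sortDesc-sorted []       = []
sortDesc-sorted (x ∷ xs) = insertDesc-sorted x (sortDesc xs) (sortDesc-sorted xs)

countEq-head : ∀ x xs → countEq x (x ∷ xs) ≡ suc (countEq x xs)
countEq-head x xs = cong (_+ countEq x xs) (T⇒𝟙≡1 (≡⇒≡ᵇ x x refl))

𝟙-≡ᵇ-≢ : ∀ {a b} → a ≢ b → 𝟙 (a ≡ᵇ b) ≡ 0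
𝟙-≡ᵇ-≢ {a} {b} a≢b = ¬T⇒𝟙≡0 (a≢b ∘ ≡ᵇ⇒≡ a b)

countEq-above : ∀ {a x} xs → Sorted (x ∷ xs) → x < a → countEq a (x ∷ xs) ≡ 0
countEq-above {a} {x} xs x∷xs↘ x<a = cong₂ _+_ (𝟙-≡ᵇ-≢ (λ a≡x → <-irrefl (sym a≡x) x<a)) (rest xs x∷xs↘)
  where
  rest : ∀ xs → Sorted (x ∷ xs) → countEq a xs ≡ 0
  rest []       _              = refl
  rest (y ∷ xs) (y≤x ∷ y∷xs↘) = countEq-above xs y∷xs↘ (≤-<-trans y≤x x<a)

sorted-countEq-injective : ∀ xs ys → Sorted xs → Sorted ys →
                           (∀ a → countEq a xs ≡ countEq a ys) → xs ≡ ys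
sorted-countEq-injective []       []       _     _     _ = refl
sorted-countEq-injective []       (y ∷ ys) _     _     h = ⊥-elim (0≢1+n (trans (h y) (countEq-head y ys)))
sorted-countEq-injective (x ∷ xs) []       _     _     h = ⊥-elim (0≢1+n (trans (sym (h x)) (countEq-head x xs)))
sorted-countEq-injective (x ∷ xs) (y ∷ ys) x∷xs↘ y∷ys↘ h with <-cmp x y
... | tri< x<y _ _ = ⊥-elim (0≢1+n (begin
  0                     ≡⟨ countEq-above xs x∷xs↘ x<y ⟨
  countEq y (x ∷ xs)    ≡⟨ h y ⟩
  countEq y (y ∷ ys)    ≡⟨ countEq-head y ys ⟩
  suc (countEq y ys)    ∎))
  where open ≡-Reasoning
... | tri> _ _ y<x = ⊥-elim (0≢1+n (begin
  0                     ≡⟨ countEq-above ys y∷ys↘ y<x ⟨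
  countEq x (y ∷ ys)    ≡⟨ h x ⟨
  countEq x (x ∷ xs)    ≡⟨ countEq-head x xs ⟩
  suc (countEq x xs)    ∎))
  where open ≡-Reasoning
... | tri≈ _ refl _ = cong (x ∷_) (sorted-countEq-injective xs ys (Linked.tail x∷xs↘) (Linked.tail y∷ys↘)
                                      (λ a → +-cancelˡ-≡ (𝟙 (a ≡ᵇ x)) _ _ (h a)))

underlying-by-counts : ∀ {xs ys} → Sorted ys → (∀ a → countEq a xs ≡ countEq a ys) → underlying xs ≡ ys
underlying-by-counts {xs} {ys} ys↘ h =
  sorted-countEq-injective (sortDesc xs) ys (sortDesc-sorted xs) ys↘ (λ a → trans (countEq-sortDesc a xs) (h a))

countEq-take-< : ∀ la {x y : Fin (L.length la)} → toℕ x < toℕ y →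
                 countEq (L.lookup la x) (L.take (toℕ x) la) < countEq (L.lookup la x) (L.take (toℕ y) la)
countEq-take-< (b ∷ la) {F.zero}  {F.suc y} _   =
  ≤-trans (s≤s z≤n) (≤-reflexive (sym (countEq-head b (L.take (toℕ y) la))))
countEq-take-< (b ∷ la) {F.suc x} {F.suc y} x<y =
  +-monoʳ-< (𝟙 (L.lookup la x ≡ᵇ b)) (countEq-take-< la {x} {y} (s<s⁻¹ x<y))

elemP-injective : ∀ la → Injective _≡_ _≡_ (elemP la)
elemP-injective la = separated⇒injective (elemP la) distinct
  where
  distinct : ∀ {x y} → toℕ x < toℕ y → elemP la x ≢ elemP la y
  distinct {x} {y} x<y eq = <-irrefl same-count (countEq-take-< la x<y)
    where
    same-count : countEq (L.lookup la x) (L.take (toℕ x) la) ≡ countEq (L.lookup la x) (L.take (toℕ y) la)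
    same-count = trans (suc-injective (cong proj₂ eq))
                       (cong (λ a → countEq a (L.take (toℕ y) la)) (sym (cong proj₁ eq)))

≤ᵇ∧tiebreak≡lexᵇ : ∀ m n c → ((m ≤ᵇ n) ∧ (not (m ≡ᵇ n) ∨ c)) ≡ ((m <ᵇ n) ∨ ((m ≡ᵇ n) ∧ c))
≤ᵇ∧tiebreak≡lexᵇ zero    zero    c = refl
≤ᵇ∧tiebreak≡lexᵇ zero    (suc n) c = refl
≤ᵇ∧tiebreak≡lexᵇ (suc m) zero    c = refl
≤ᵇ∧tiebreak≡lexᵇ (suc m) (suc n) c = trans (cong (λ b → b ∧ (not (m ≡ᵇ n) ∨ c)) (<ᵇ-suc m n))
                                           (≤ᵇ∧tiebreak≡lexᵇ m n c)
  where
  <ᵇ-suc : ∀ m n → (m <ᵇ suc n) ≡ (m ≤ᵇ n)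
  <ᵇ-suc zero    n = refl
  <ᵇ-suc (suc m) n = refl

expVec-permute : ∀ {N} L (π : Permutation′ N) {f f′ : Vec (Fin L) N} {w w′ : Vec ℕ N} →
                 (∀ k → V.lookup f′ k ≡ V.lookup f (π ⟨$⟩ʳ k)) →
                 (∀ k → V.lookup w′ k ≡ V.lookup w (π ⟨$⟩ʳ k)) →
                 expVec L f′ w′ ≡ expVec L f w
expVec-permute {N} L π {f} {f′} {w} {w′} f′≡ w′≡ = VP.tabulate-cong (λ i → begin
  V.sum (V.zipWith (c i) f′ w′)                                  ≡⟨ sum-zipWith (c i) f′ w′ ⟩
  ∑[ k ∈ L.allFin N ] c i (V.lookup f′ k) (V.lookup w′ k)
    ≡⟨ ∑-cong (L.allFin N) (λ k → cong₂ (c i) (f′≡ k) (w′≡ k)) ⟩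
  ∑[ k ∈ L.allFin N ] c i (V.lookup f (π ⟨$⟩ʳ k)) (V.lookup w (π ⟨$⟩ʳ k))
    ≡⟨ ∑-permute π (λ k → c i (V.lookup f k) (V.lookup w k)) ⟩
  ∑[ k ∈ L.allFin N ] c i (V.lookup f k) (V.lookup w k)           ≡⟨ sum-zipWith (c i) f w ⟨
  V.sum (V.zipWith (c i) f w)                                    ∎)
  where
  open ≡-Reasoning
  c : Fin L → Fin L → ℕ → ℕ
  c i fu wu = if ⌊ fu F.≟ i ⌋ then wu else 0

isChainPartition≡lexᵇ : ∀ {C : Set} (_<C_ : C → C → Bool) {m L} (γ : Vec C m) (f : Vec (Fin L) m) →
  isChainPartition _<C_ γ f ≡
  allPairs (λ a b → lexᵇ _<C_ (toℕ (V.lookup f a) , V.lookup γ a) (toℕ (V.lookup f b) , V.lookup γ b))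
isChainPartition≡lexᵇ _<C_ γ f = allPairs-cong (λ a b →
  ≤ᵇ∧tiebreak≡lexᵇ (toℕ (V.lookup f a)) (toℕ (V.lookup f b)) (V.lookup γ a <C V.lookup γ b))

-- The body of combPowerSumCoeff α for an arbitrary list in place of underlying α, so that it
-- can be transported along underlying α ≡ λ.
listingSum : (la : List ℕ) (α : List ℕ) (L : ℕ) → Vec ℕ L → ℕ
listingSum la α L e =
  ∑[ ord ∈ allVecs (L.length la) (L.length la) ]
    (if isTotalOrderListing ord ∧ (V.toList (chainWeights la ord) ≡ˡ α)
     then chainKCoeff _<NN*_ (chainLabels la ord) (chainWeights la ord) L e
     else 0)

combPowerSumCoeff≡listingSum : ∀ α L e → combPowerSumCoeff α L e ≡ listingSum (underlying α) α L e
combPowerSumCoeff≡listingSum α L e = sumL-map _ (allVecs (L.length (underlying α)) (L.length (underlying α)))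

lookup-chainWeights : ∀ la (ord : Vec (Fin (L.length la)) (L.length la)) k →
                      V.lookup (chainWeights la ord) k ≡ L.lookup la (V.lookup ord k)
lookup-chainWeights la ord k =
  trans (VP.lookup-map k proj₁ (chainLabels la ord)) (cong proj₁ (VP.lookup-map k (elemP la) ord))

module PowerSumExpansion (la : List ℕ) (la-partition : IsPartition la) (L : ℕ) (e : Vec ℕ L) where

  N : ℕ
  N = L.length la

  listings : List (Vec (Fin N) N)
  listings = allVecs N N

  maps : List (Vec (Fin L) N)
  maps = allVecs N L

  comps : List (List ℕ)
  comps = compositions (sumL la)

  weights : Vec (Fin N) N → List ℕ
  weights ord = V.toList (chainWeights la ord)

  K : Vec (Fin N) N → ℕ
  K ord = chainKCoeff _<NN*_ (chainLabels la ord) (chainWeights la ord) L e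

  contribution : List ℕ → Vec (Fin N) N → ℕ
  contribution α ord = if isTotalOrderListing ord ∧ (weights ord ≡ˡ α) then K ord else 0

  hasMonomial : Vec (Fin L) N → Bool
  hasMonomial j = expVec L j (V.fromList la) ≡ᵛ e

  key : Vec (Fin L) N → Fin N → ℕ × (ℕ × ℕ)
  key j x = (toℕ (V.lookup j x) , elemP la x)

  keyOrder : Vec (Fin L) N → Fin N → Fin N → Bool
  keyOrder j x y = lexᵇ _<NN*_ (key j x) (key j y)

  keyOrder-isStrictTotal : ∀ j → IsStrictTotalᵇ (keyOrder j)
  keyOrder-isStrictTotal j = on-isStrictTotal (key j) (elemP-injective la ∘ cong proj₂)
                               (lex-isStrictTotal (flip-isStrictTotal <NN-isStrictTotal))

  sortsBy : Vec (Fin L) N → Vec (Fin N) N → Bool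
  sortsBy j = IncreasingListings.increasingᵇ (keyOrder-isStrictTotal j)

  listing⇒permutation : ∀ ord → T (isTotalOrderListing ord) → Permutation′ N
  listing⇒permutation ord t = injective⇒permutation (V.lookup ord) (T-isTotalOrderListing⇒injective ord t)

  ∑-weights : ∀ ord → T (isTotalOrderListing ord) → ∀ h → ∑ (weights ord) h ≡ ∑ la h
  ∑-weights ord t h = begin
    ∑ (weights ord) h                                          ≡⟨ ∑-toList (chainWeights la ord) h ⟩
    ∑[ k ∈ L.allFin N ] h (V.lookup (chainWeights la ord) k)
      ≡⟨ ∑-cong (L.allFin N) (cong h ∘ lookup-chainWeights la ord) ⟩
    ∑[ k ∈ L.allFin N ] h (L.lookup la (V.lookup ord k))
      ≡⟨ ∑-permute (listing⇒permutation ord t) (h ∘ L.lookup la) ⟩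
    ∑[ i ∈ L.allFin N ] h (L.lookup la i)                      ≡⟨ ∑-lookup la h ⟨
    ∑ la h                                                     ∎
    where open ≡-Reasoning

  weights-positive : ∀ ord → Positive (weights ord)
  weights-positive ord = toList⁺ (lookup⁻ (λ k → subst (0 <_) (sym (lookup-chainWeights la ord k))
                                      (All.lookup (proj₁ la-partition) (∈-lookup (V.lookup ord k)))))

  weights-sum : ∀ ord → T (isTotalOrderListing ord) → sumL (weights ord) ≡ sumL la
  weights-sum ord t = trans (sumL≡∑ (weights ord)) (trans (∑-weights ord t id) (sym (sumL≡∑ la)))

  underlying-weights : ∀ ord → T (isTotalOrderListing ord) → underlying (weights ord) ≡ la
  underlying-weights ord t = underlying-by-counts {weights ord} (proj₂ la-partition) (λ a → begin
    countEq a (weights ord)                   ≡⟨ countB≡∑𝟙 _ (weights ord) ⟩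
    ∑[ b ∈ weights ord ] 𝟙 (a ≡ᵇ b)           ≡⟨ ∑-weights ord t (λ b → 𝟙 (a ≡ᵇ b)) ⟩
    ∑[ b ∈ la ] 𝟙 (a ≡ᵇ b)                    ≡⟨ countB≡∑𝟙 _ la ⟨
    countEq a la                              ∎)
    where open ≡-Reasoning

  sumCombPowerSumCoeff≡∑-listingSum :
    sumCombPowerSumCoeff la L e ≡ ∑[ α ∈ comps ] 𝟙 (underlying α ≡ˡ la) * listingSum la α L e
  sumCombPowerSumCoeff≡∑-listingSum = trans (sumL-map _ comps) (∑-cong comps (λ α →
    trans (if-then-0≡𝟙* (underlying α ≡ˡ la) (combPowerSumCoeff α L e))
          (𝟙*-cong (underlying α ≡ˡ la) (λ ũα≡la →
            trans (combPowerSumCoeff≡listingSum α L e)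
                  (cong (λ la′ → listingSum la′ α L e) (≡ˡ⇒≡ ũα≡la))))))

  ∑-compositions-contribution : ∀ ord →
    ∑[ α ∈ comps ] 𝟙 (underlying α ≡ˡ la) * (if isTotalOrderListing ord ∧ (weights ord ≡ˡ α) then K ord else 0)
    ≡ 𝟙 (isTotalOrderListing ord) * K ord
  ∑-compositions-contribution ord with isTotalOrderListing ord in listing
  ... | false = trans (∑-cong comps (λ α → *-zeroʳ (𝟙 (underlying α ≡ˡ la)))) (∑-zero comps)
  ... | true  = begin
    ∑[ α ∈ comps ] 𝟙 (underlying α ≡ˡ la) * (if weights ord ≡ˡ α then K ord else 0)
      ≡⟨ ∑-cong comps (λ α → trans (cong (𝟙 (underlying α ≡ˡ la) *_) (if-then-0≡𝟙* (weights ord ≡ˡ α) (K ord)))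
                                   (𝟙*-absorb {underlying α ≡ˡ la} {weights ord ≡ˡ α} (K ord)
                                              (≡⇒≡ˡ ∘ underlying-≡ α ∘ ≡ˡ⇒≡))) ⟩
    ∑[ α ∈ comps ] 𝟙 (weights ord ≡ˡ α) * K ord
      ≡⟨ ∑-*ʳ comps (K ord) (λ α → 𝟙 (weights ord ≡ˡ α)) ⟩
    (∑[ α ∈ comps ] 𝟙 (weights ord ≡ˡ α)) * K ord
      ≡⟨ cong (_* K ord) (compositions-enumerate (sumL la) (weights ord)
                                                 (weights-positive ord) (weights-sum ord t)) ⟩
    1 * K ord ∎
    where
    open ≡-Reasoning
    t : T (isTotalOrderListing ord)
    t = subst T (sym listing) tt
    underlying-≡ : ∀ α → weights ord ≡ α → underlying α ≡ la
    underlying-≡ α refl = underlying-weights ord t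

  isChainPartition≡sortsBy : ∀ ord j →
    isChainPartition _<NN*_ (chainLabels la ord) (reorder (V.lookup ord) j) ≡ sortsBy j ord
  isChainPartition≡sortsBy ord j =
    trans (isChainPartition≡lexᵇ _<NN*_ (chainLabels la ord) (reorder (V.lookup ord) j))
          (allPairs-cong (λ a b → cong₂ (lexᵇ _<NN*_) (key-at a) (key-at b)))
    where
    key-at : ∀ a → (toℕ (V.lookup (reorder (V.lookup ord) j) a) , V.lookup (chainLabels la ord) a)
                   ≡ key j (V.lookup ord a)
    key-at a = cong₂ _,_ (cong toℕ (lookup-reorder (V.lookup ord) j a)) (VP.lookup-map a (elemP la) ord)

  K≡∑-sortsBy : ∀ ord → T (isTotalOrderListing ord) →
                K ord ≡ ∑[ j ∈ maps ] 𝟙 (sortsBy j ord) * 𝟙 (hasMonomial j)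
  K≡∑-sortsBy ord t = begin
    K ord
      ≡⟨ countB≡∑𝟙 _ maps ⟩
    ∑[ f ∈ maps ] 𝟙 (isChainPartition _<NN*_ γ f ∧ (expVec L f w ≡ᵛ e))
      ≡⟨ ∑-allVecs-reorder π (λ f → 𝟙 (isChainPartition _<NN*_ γ f ∧ (expVec L f w ≡ᵛ e))) ⟨
    ∑[ j ∈ maps ] 𝟙 (isChainPartition _<NN*_ γ (reorder σ j) ∧ (expVec L (reorder σ j) w ≡ᵛ e))
      ≡⟨ ∑-cong maps (λ j → trans (𝟙-∧ (isChainPartition _<NN*_ γ (reorder σ j)) _)
                                  (cong₂ (λ b c → 𝟙 b * 𝟙 c) (isChainPartition≡sortsBy ord j)
                                                             (cong (_≡ᵛ e) (same-monomial j)))) ⟩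
    ∑[ j ∈ maps ] 𝟙 (sortsBy j ord) * 𝟙 (hasMonomial j) ∎
    where
    open ≡-Reasoning
    γ : Vec (ℕ × ℕ) N
    γ = chainLabels la ord
    w : Vec ℕ N
    w = chainWeights la ord
    σ : Fin N → Fin N
    σ = V.lookup ord
    π : Permutation′ N
    π = listing⇒permutation ord t
    same-monomial : ∀ j → expVec L (reorder σ j) w ≡ expVec L j (V.fromList la)
    same-monomial j = expVec-permute L π {j} {reorder σ j} {V.fromList la} {w} (lookup-reorder σ j)
      (λ k → trans (lookup-chainWeights la ord k) (sym (lookup-fromList la (σ k))))

  listingSummand≡∑-sortsBy : ∀ ord → 𝟙 (isTotalOrderListing ord) * K ord ≡
    ∑[ j ∈ maps ] 𝟙 (isTotalOrderListing ord ∧ sortsBy j ord) * 𝟙 (hasMonomial j)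
  listingSummand≡∑-sortsBy ord with isTotalOrderListing ord in listing
  ... | false = sym (∑-zero maps)
  ... | true  = trans (*-identityˡ (K ord)) (K≡∑-sortsBy ord (subst T (sym listing) tt))

  ∑-listings-sortsBy : ∀ j →
    ∑[ ord ∈ listings ] 𝟙 (isTotalOrderListing ord ∧ sortsBy j ord) * 𝟙 (hasMonomial j) ≡ 𝟙 (hasMonomial j)
  ∑-listings-sortsBy j = begin
    ∑[ ord ∈ listings ] 𝟙 (isTotalOrderListing ord ∧ sortsBy j ord) * 𝟙 (hasMonomial j)
      ≡⟨ ∑-*ʳ listings (𝟙 (hasMonomial j)) _ ⟩
    (∑[ ord ∈ listings ] 𝟙 (isTotalOrderListing ord ∧ sortsBy j ord)) * 𝟙 (hasMonomial j)
      ≡⟨ cong (_* 𝟙 (hasMonomial j)) (IncreasingListings.∑-increasing-listings (keyOrder-isStrictTotal j)) ⟩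
    1 * 𝟙 (hasMonomial j)
      ≡⟨ *-identityˡ _ ⟩
    𝟙 (hasMonomial j) ∎
    where open ≡-Reasoning

theorem5p4 : (la : List ℕ) → IsPartition la →
    (L : ℕ) (e : Vec ℕ L) →
    powerSumCoeff la L e ≡ sumCombPowerSumCoeff la L e
theorem5p4 la la-partition L e = sym (begin
  sumCombPowerSumCoeff la L e
    ≡⟨ sumCombPowerSumCoeff≡∑-listingSum ⟩
  ∑[ α ∈ comps ] 𝟙 (underlying α ≡ˡ la) * listingSum la α L e
    ≡⟨ ∑-cong comps (λ α → sym (∑-*ˡ listings (𝟙 (underlying α ≡ˡ la)) _)) ⟩
  ∑[ α ∈ comps ] ∑[ ord ∈ listings ] 𝟙 (underlying α ≡ˡ la) * contribution α ord
    ≡⟨ ∑-comm comps listings _ ⟩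
  ∑[ ord ∈ listings ] ∑[ α ∈ comps ] 𝟙 (underlying α ≡ˡ la) * contribution α ord
    ≡⟨ ∑-cong listings ∑-compositions-contribution ⟩
  ∑[ ord ∈ listings ] 𝟙 (isTotalOrderListing ord) * K ord
    ≡⟨ ∑-cong listings listingSummand≡∑-sortsBy ⟩
  ∑[ ord ∈ listings ] ∑[ j ∈ maps ] 𝟙 (isTotalOrderListing ord ∧ sortsBy j ord) * 𝟙 (hasMonomial j)
    ≡⟨ ∑-comm listings maps _ ⟩
  ∑[ j ∈ maps ] ∑[ ord ∈ listings ] 𝟙 (isTotalOrderListing ord ∧ sortsBy j ord) * 𝟙 (hasMonomial j)
    ≡⟨ ∑-cong maps ∑-listings-sortsBy ⟩
  ∑[ j ∈ maps ] 𝟙 (hasMonomial j)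
    ≡⟨ countB≡∑𝟙 hasMonomial maps ⟨
  powerSumCoeff la L e ∎)
  where
  open PowerSumExpansion la la-partition L e
  open ≡-Reasoning
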